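{- For all integers $h\ge r\ge1$ and $k\ge1$ there exist an integer $C\ge1$ and reals $\varepsilon,\gamma\in(0,1)$ such that the following holds. Let $G$ be an $r$-uniform hypergraph with $v(G)\ge C$ and $\delta(G)\ge(1-\varepsilon)\cdot v(G)$. If $Y$ is an $h$-bounded multi-hypergraph with $V(Y)=V(G)$, edge-disjoint from $G$, with $\Delta_{r-1}(Y)\le\gamma\cdot v(G)$ and $|e|\ge r$ for all $e\in E(Y)$, then there exist pairwise edge-disjoint subgraphs $(T_e: e\in E(Y))$ of $G$ such that each $T_e$ is a partial $K_{k+|e|}^r$ rooted at $V(e)$, and letting $T:=\bigcup_{e\in E(Y)}T_e$, we have $\Delta(T)\le C\cdot\Delta_{r-1}(Y)$.
   Context: An $r$-uniform hypergraph $G$ has vertex set $V(G)$ ($v(G)=|V(G)|$) and a set of $r$-subsets as edges; identified with its edge set. For an $(r-1)$-set $S$, $|G(S)|$ is the number of edges containing $S$; $\Delta(G)=\max_S|G(S)|$, $\delta(G)=\min_S|G(S)|$ over $(r-1)$-subsets $S$ of $V(G)$. An $h$-bounded multi-hypergraph $Y$ has a multiset of edges that are subsets of $V(Y)$ of size at most $h$ (parallel copies distinct edges); $\Delta_{r-1}(Y)$ is the maximum over $(r-1)$-sets $S$ of the number of edges of $Y$ (with multiplicity) containing $S$. "Edge-disjoint from $G$" means no edge of $Y$ is an edge of $G$. For a vertex set $S$ with $r\le|S|<m$, a partial $K_m^r$ rooted at $S$ in $G$ is a subgraph $T$ of $G$ whose vertex set $U$ satisfies $S\subseteq U$, $|U|=m$,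 and whose edge set is $\binom Ur\setminus\binom Sr$ (all of which are edges of $G$). -}

module Defs where

open import Data.Bool using (Bool; true; false; _∧_)
open import Data.Nat using (ℕ; zero; suc; _⊔_; _∸_)
open import Data.Nat.Properties using (_≟_)
open import Data.Fin using (Fin)
open import Data.Fin.Subset using (Subset; _⊆_; ∣_∣)
open import Data.Fin.Subset.Properties using (_⊆?_)
open import Data.List using (List; []; _∷_; _++_; map; filterᵇ; length; foldr; allFin)
open import Data.Bool.ListAction using (any)
open import Data.Vec using (Vec; []; _∷_)
open import Data.Product using (Σ; _×_)
open import Relation.Nullary using (¬_; ⌊_⌋)
open import Relation.Binary.PropositionalEquality using (_≡_)
open import Function.Bundles using (_⇔_)

allSubsets : ∀ n → List (Subset n)
allSubsets zero = [] ∷ []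
allSubsets (suc n) = map (false ∷_) (allSubsets n) ++ map (true ∷_) (allSubsets n)

Hypergraph : ℕ → Set
Hypergraph n = Subset n → Bool

IsUniform : ∀ {n} → ℕ → Hypergraph n → Set
IsUniform r G = ∀ f → G f ≡ true → ∣ f ∣ ≡ r

deg : ∀ {n} → Hypergraph n → Subset n → ℕ
deg {n} G S = length (filterᵇ (λ f → G f ∧ ⌊ S ⊆? f ⌋) (allSubsets n))

degM : ∀ {n} → List (Subset n) → Subset n → ℕ
degM Y S = length (filterᵇ (λ e → ⌊ S ⊆? e ⌋) Y)

maxOver : ∀ {n} → ℕ → (Subset n → ℕ) → ℕ
maxOver {n} r d = foldr _⊔_ 0 (map d (filterᵇ (λ S → ⌊ ∣ S ∣ ≟ r ∸ 1 ⌋) (allSubsets n)))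

Δ : ∀ {n} → ℕ → Hypergraph n → ℕ
Δ r G = maxOver r (deg G)

Δmulti : ∀ {n} → ℕ → List (Subset n) → ℕ
Δmulti r Y = maxOver r (degM Y)

IsPartialK : ∀ {n} → Hypergraph n → ℕ → Subset n → ℕ → Hypergraph n → Set
IsPartialK {n} G r S m T =
  Σ (Subset n) λ U →
    S ⊆ U × ∣ U ∣ ≡ m
    × (∀ f → (T f ≡ true) ⇔ (∣ f ∣ ≡ r × f ⊆ U × ¬ (f ⊆ S)))
    × (∀ f → T f ≡ true → G f ≡ true)

unionH : ∀ {n m} → (Fin m → Hypergraph n) → Hypergraph n
unionH {m = m} T f = any (λ i → T i f) (allFin m)

-- The cliques are built greedily, one edge e of Y at a time, by growing U ⊇ e one vertex at a time
-- until ∣ U ∣ = k + ∣ e ∣.  Let K = k + h, D = Δ_{r-1}(Y), ε = 1/(4·2^K), B₀ = 0, B_{j+1} = K·(B_j + 1)/ε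
-- and γ = ε/(K·(B_{r-1} + 1)); call the number of earlier cliques containing a set W its load.  The
-- invariant is that every j-set with j < r has load at most B_j·D·n^(r-1-j) plus its degree in Y.
-- A vertex x may join U unless for some Z ⊆ U the set Z ∪ {x} is an r-set outside G or inside an
-- earlier clique, or a smaller set of load at least B_{∣Z∣+1}·D·n^(r-2-∣Z∣).  For fixed Z, the minimum
-- degree of G excludes at most εn vertices of the first kind; double counting,
-- Σ_x load(Z ∪ {x}) ≤ K·load(Z), together with D ≤ γn excludes at most εn of the second.  As U has
-- fewer than 2^K subsets, fewer than n vertices are excluded.  So new r-sets are edges of G lying in
-- no earlier clique, and in the end an (r-1)-set lies in at most (B_{r-1} + 1)·D cliques, each of
-- which has at most K edges through it.

module Submission where

open import Defs
import Algebra.Properties.CommutativeSemigroup as CommutativeSemigroupProperties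
open import Data.Bool using (Bool; true; false; not; _∧_)
open import Data.Bool.ListAction using (any)
open import Data.Bool.Properties using () renaming (_≟_ to _≟ᵇ_)
open import Data.Empty using (⊥)
open import Data.Fin using (Fin; zero; suc)
open import Data.Fin.Subset using (Subset; inside; outside; _∈_; _∉_; _⊆_; _⊂_; ∣_∣; _∪_; _∩_; ⁅_⁆) renaming (⊥ to ∅)
open import Data.Fin.Subset.Properties
  using (_∈?_; _⊆?_; drop-∷-⊆; out⊂; in⊂in; s⊆s; ⊥⊆; ∣⊥∣≡0; ⊆-antisym; p⊂q⇒∣p∣<∣q∣; ∪-identityʳ;
         p⊆p∪q; q⊆p∪q; x∈p∪q⁻; x∈p∩q⁺; x∈p∩q⁻; x∈⁅x⁆; x∈⁅y⁆⇒x≡y)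
open import Data.Integer as ℤ using (+<+)
import Data.Integer.Properties as ℤP
import Data.Integer.Tactic.RingSolver as ℤ-Ring
open import Data.List using (List; []; _∷_; _++_; map; foldr; length; filterᵇ; lookup; tabulate; allFin)
open import Data.List.Properties using (map-tabulate; length-tabulate)
open import Data.List.Membership.Propositional using () renaming (_∈_ to _∈ₗ_)
open import Data.List.Membership.Propositional.Properties using (∈-++⁺ˡ; ∈-++⁺ʳ; ∈-map⁺; ∈-allFin; ∈-lookup; ∈-tabulate⁺)
open import Data.List.Relation.Unary.All as All using (All; []; _∷_)
open import Data.List.Relation.Unary.All.Properties using (tabulate⁺)
import Data.List.Relation.Unary.Any as Any
open import Data.Nat using (ℕ; zero; suc; _+_; _*_; _^_; _∸_; _⊔_; _≤_; _<_; z≤n; s≤s; _≤?_; _<?_; NonZero; >-nonZero)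
open import Data.Nat.Properties
open import Data.Nat.Tactic.RingSolver using (solve-∀)
open import Data.Product using (Σ; ∃; _×_; _,_; proj₁; proj₂)
import Data.Rational as ℚ
open import Data.Rational using (ℚ; 0ℚ; 1ℚ; _/_; _-_; toℚᵘ) renaming (_*_ to _*ℚ_; _≤_ to _≤ℚ_; _<_ to _<ℚ_)
open import Data.Rational.Properties
  using (positive⁻¹; normalize-pos; toℚᵘ-mono-≤; toℚᵘ-cancel-<; toℚᵘ-fromℚᵘ; toℚᵘ-homo-*; toℚᵘ-homo-+; toℚᵘ-homo‿-)
open import Data.Rational.Unnormalised as ℚᵘ using (mkℚᵘ; *≤*; *<*; _≃_)
import Data.Rational.Unnormalised.Properties as ℚᵘP
open import Data.Sum using (inj₁; inj₂; [_,_]′)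
open import Data.Vec using ([]; _∷_; here; there)
open import Data.Vec.Properties using (≡-dec; ∷-injectiveʳ)
import Data.Vec.Functional as Vector
open import Function using (id; _∘_; _⇔_; mk⇔; Equivalence)
open import Relation.Nullary using (Dec; does; yes; no; ¬_; ¬?; contradiction; _×-dec_)
open import Relation.Nullary.Decidable using (decidable-stable; dec-true; dec-false; does-⇔; isYes≗does)
open import Relation.Binary.Definitions using (DecidableEquality)
open import Relation.Binary.PropositionalEquality using (_≡_; _≢_; refl; sym; trans; cong; cong₂; subst; module ≡-Reasoning)

open CommutativeSemigroupProperties +-commutativeSemigroup using () renaming (interchange to +-interchange)
open CommutativeSemigroupProperties *-commutativeSemigroup using (x∙yz≈y∙xz)

private variable
  A : Set
  n : ℕ

-- Iverson brackets and finite sums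

ind : Bool → ℕ
ind false = 0
ind true  = 1

[_] : ∀ {p} {P : Set p} → Dec P → ℕ
[ P? ] = ind (does P?)

ind-∧ : ∀ a b → ind (a ∧ b) ≡ ind a * ind b
ind-∧ false b = refl
ind-∧ true  b = sym (+-identityʳ (ind b))

ind-not+ind : ∀ b → ind (not b) + ind b ≡ 1
ind-not+ind false = refl
ind-not+ind true  = refl

ind-not≡0⇒ : ∀ {b} → ind (not b) ≡ 0 → b ≡ true
ind-not≡0⇒ {true} _ = refl

module _ {a} {P : Set a} where

  []-yes : (P? : Dec P) → P → [ P? ] ≡ 1
  []-yes P? p rewrite dec-true P? p = refl

  []-no : (P? : Dec P) → ¬ P → [ P? ] ≡ 0
  []-no P? ¬p rewrite dec-false P? ¬p = refl

  []≡0⇒¬ : (P? : Dec P) → [ P? ] ≡ 0 → ¬ P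
  []≡0⇒¬ P? [P]≡0 p = contradiction (trans (sym ([]-yes P? p)) [P]≡0) λ ()

  []*≡0⇒ : (P? : Dec P) {m : ℕ} → [ P? ] * m ≡ 0 → P → m ≡ 0
  []*≡0⇒ P? [P]*m≡0 p = trans (sym (+-identityʳ _)) (subst (λ i → i * _ ≡ 0) ([]-yes P? p) [P]*m≡0)

  []*-≤ : (P? : Dec P) {m n : ℕ} → (P → m ≤ n) → [ P? ] * m ≤ n
  []*-≤ (yes p) m≤n = ≤-trans (≤-reflexive (+-identityʳ _)) (m≤n p)
  []*-≤ (no _)  m≤n = z≤n

[]-⇔× : ∀ {a b c} {P : Set a} {Q : Set b} {R : Set c} → R ⇔ (P × Q) →
        (R? : Dec R) (P? : Dec P) (Q? : Dec Q) → [ R? ] ≡ [ P? ] * [ Q? ]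
[]-⇔× R⇔P×Q R? P? Q? = trans (cong ind (does-⇔ R⇔P×Q R? (P? ×-dec Q?))) (ind-∧ (does P?) (does Q?))

does≡true⇔ : ∀ {p} {P : Set p} (P? : Dec P) → (does P? ≡ true) ⇔ P
does≡true⇔ (yes p) = mk⇔ (λ _ → p) (λ _ → refl)
does≡true⇔ (no ¬p) = mk⇔ (λ ()) (λ p → contradiction p ¬p)

[]-mono : ∀ {p q} {P : Set p} {Q : Set q} (P? : Dec P) (Q? : Dec Q) → (P → Q) → [ P? ] ≤ [ Q? ]
[]-mono (yes p) (yes _) _   = ≤-refl
[]-mono (yes p) (no ¬q) P→Q = contradiction (P→Q p) ¬q
[]-mono (no _)  _       _   = z≤n

m*[m≤?n]≤n : ∀ m n → m * [ m ≤? n ] ≤ n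
m*[m≤?n]≤n m n = ≤-trans (≤-reflexive (*-comm m _)) ([]*-≤ (m ≤? n) id)

∑ : List A → (A → ℕ) → ℕ
∑ []       f = 0
∑ (a ∷ as) f = f a + ∑ as f

infixl 10 ∑
syntax ∑ L (λ a → e) = ∑[ a ∈ L ] e

∑-cong : ∀ (L : List A) {f g : A → ℕ} → (∀ a → f a ≡ g a) → ∑ L f ≡ ∑ L g
∑-cong []      f≡g = refl
∑-cong (a ∷ L) f≡g = cong₂ _+_ (f≡g a) (∑-cong L f≡g)

∑-mono-∈ : ∀ (L : List A) {f g : A → ℕ} → (∀ {a} → a ∈ₗ L → f a ≤ g a) → ∑ L f ≤ ∑ L g
∑-mono-∈ []      f≤g = z≤n
∑-mono-∈ (a ∷ L) f≤g = +-mono-≤ (f≤g (Any.here refl)) (∑-mono-∈ L (f≤g ∘ Any.there))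

∑-mono : ∀ (L : List A) {f g : A → ℕ} → (∀ a → f a ≤ g a) → ∑ L f ≤ ∑ L g
∑-mono L f≤g = ∑-mono-∈ L (λ {a} _ → f≤g a)

∑-zero : ∀ (L : List A) {f : A → ℕ} → (∀ a → f a ≡ 0) → ∑ L f ≡ 0
∑-zero []      f≡0 = refl
∑-zero (a ∷ L) f≡0 = cong₂ _+_ (f≡0 a) (∑-zero L f≡0)

∑-const : ∀ (L : List A) c → ∑[ _ ∈ L ] c ≡ length L * c
∑-const []      c = refl
∑-const (a ∷ L) c = cong (_+_ c) (∑-const L c)

∑-distrib-+ : ∀ (L : List A) (f g : A → ℕ) → ∑[ a ∈ L ] (f a + g a) ≡ ∑ L f + ∑ L g
∑-distrib-+ []      f g = refl
∑-distrib-+ (a ∷ L) f g = trans (cong (_+_ (f a + g a)) (∑-distrib-+ L f g)) (+-interchange (f a) (g a) _ _)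

*-distribˡ-∑ : ∀ c (L : List A) (f : A → ℕ) → c * ∑ L f ≡ ∑[ a ∈ L ] (c * f a)
*-distribˡ-∑ c []      f = *-zeroʳ c
*-distribˡ-∑ c (a ∷ L) f = trans (*-distribˡ-+ c (f a) (∑ L f)) (cong (_+_ (c * f a)) (*-distribˡ-∑ c L f))

∑-comm : ∀ {B : Set} (L : List A) (M : List B) (f : A → B → ℕ) →
         ∑[ a ∈ L ] ∑[ b ∈ M ] f a b ≡ ∑[ b ∈ M ] ∑[ a ∈ L ] f a b
∑-comm []      M f = sym (∑-zero M (λ _ → refl))
∑-comm (a ∷ L) M f = trans (cong (_+_ (∑ M (f a))) (∑-comm L M f)) (sym (∑-distrib-+ M (f a) _))

∑-++ : ∀ (L M : List A) (f : A → ℕ) → ∑ (L ++ M) f ≡ ∑ L f + ∑ M f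
∑-++ []      M f = refl
∑-++ (a ∷ L) M f = trans (cong (_+_ (f a)) (∑-++ L M f)) (sym (+-assoc (f a) _ _))

∑-map : ∀ {B : Set} (g : B → A) (L : List B) (f : A → ℕ) → ∑ (map g L) f ≡ ∑ L (f ∘ g)
∑-map g []      f = refl
∑-map g (b ∷ L) f = cong (_+_ (f (g b))) (∑-map g L f)

∈⇒≤∑ : ∀ {L : List A} (f : A → ℕ) {a} → a ∈ₗ L → f a ≤ ∑ L f
∈⇒≤∑ f (Any.here refl) = m≤m+n _ _
∈⇒≤∑ {L = b ∷ L} f (Any.there a∈L) = ≤-trans (∈⇒≤∑ f a∈L) (m≤n+m _ (f b))

∑<length⇒∃≡0 : ∀ (L : List A) (f : A → ℕ) → ∑ L f < length L → ∃ λ a → f a ≡ 0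
∑<length⇒∃≡0 (a ∷ L) f ∑<len with f a in fa≡
... | zero  = a , fa≡
... | suc _ = ∑<length⇒∃≡0 L f (≤-trans (s≤s (m≤n+m _ _)) (≤-pred ∑<len))

length-filterᵇ≡∑ : ∀ (p : A → Bool) (L : List A) → length (filterᵇ p L) ≡ ∑[ a ∈ L ] ind (p a)
length-filterᵇ≡∑ p []      = refl
length-filterᵇ≡∑ p (a ∷ L) with p a
... | true  = cong suc (length-filterᵇ≡∑ p L)
... | false = length-filterᵇ≡∑ p L

ind-any≤∑ : ∀ (p : A → Bool) (L : List A) → ind (any p L) ≤ ∑[ a ∈ L ] ind (p a)
ind-any≤∑ p []      = z≤n
ind-any≤∑ p (a ∷ L) with p a
... | true  = s≤s z≤n
... | false = ind-any≤∑ p L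

∑-allFin-suc : ∀ {m} (f : Fin (suc m) → ℕ) → ∑ (allFin (suc m)) f ≡ f zero + ∑ (allFin m) (f ∘ suc)
∑-allFin-suc {m} f = cong (_+_ (f zero)) (trans (cong (λ L → ∑ L f) (sym (map-tabulate id suc))) (∑-map suc (allFin m) f))

length-allFin : ∀ n → length (allFin n) ≡ n
length-allFin n = length-tabulate id

∑-tabulate : ∀ {m} (f : Fin m → A) (g : A → ℕ) → ∑ (tabulate f) g ≡ ∑[ i ∈ allFin m ] g (f i)
∑-tabulate {m = m} f g = trans (cong (λ L → ∑ L g) (sym (map-tabulate id f))) (∑-map f (allFin m) g)

∑-∈ : ∀ (U : Subset n) → ∑[ x ∈ allFin n ] [ x ∈? U ] ≡ ∣ U ∣
∑-∈ []            = refl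
∑-∈ (inside  ∷ U) = trans (∑-allFin-suc (λ x → [ x ∈? inside ∷ U ])) (cong suc (∑-∈ U))
∑-∈ (outside ∷ U) = trans (∑-allFin-suc (λ x → [ x ∈? outside ∷ U ])) (∑-∈ U)

∑-allSubsets-suc : ∀ (g : Subset (suc n) → ℕ) →
  ∑ (allSubsets (suc n)) g ≡ ∑ (allSubsets n) (g ∘ (outside ∷_)) + ∑ (allSubsets n) (g ∘ (inside ∷_))
∑-allSubsets-suc {n} g = begin
  ∑ (map (outside ∷_) (allSubsets n) ++ map (inside ∷_) (allSubsets n)) g  ≡⟨ ∑-++ (map (outside ∷_) (allSubsets n)) _ g ⟩
  ∑ (map (outside ∷_) (allSubsets n)) g + ∑ (map (inside ∷_) (allSubsets n)) g
    ≡⟨ cong₂ _+_ (∑-map _ (allSubsets n) g) (∑-map _ (allSubsets n) g) ⟩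
  ∑ (allSubsets n) (g ∘ (outside ∷_)) + ∑ (allSubsets n) (g ∘ (inside ∷_))  ∎
  where open ≡-Reasoning

∈-allSubsets : ∀ (Z : Subset n) → Z ∈ₗ allSubsets n
∈-allSubsets []            = Any.here refl
∈-allSubsets (outside ∷ Z) = ∈-++⁺ˡ (∈-map⁺ (outside ∷_) (∈-allSubsets Z))
∈-allSubsets (inside  ∷ Z) = ∈-++⁺ʳ _ (∈-map⁺ (inside ∷_) (∈-allSubsets Z))

∑-allSubsets-single : ∀ (A : Subset n) (g : Subset n → ℕ) → (∀ Z → Z ≢ A → g Z ≡ 0) →
  ∑[ Z ∈ allSubsets n ] g Z ≡ g A
∑-allSubsets-single []            g g≡0 = +-identityʳ _
∑-allSubsets-single {suc n} (outside ∷ A) g g≡0 = begin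
  ∑ (allSubsets (suc n)) g                                ≡⟨ ∑-allSubsets-suc g ⟩
  ∑ (allSubsets n) (g ∘ (outside ∷_)) + ∑ (allSubsets n) (g ∘ (inside ∷_))
    ≡⟨ cong₂ _+_ (∑-allSubsets-single A _ (λ Z Z≢A → g≡0 _ (Z≢A ∘ ∷-injectiveʳ)))
                 (∑-zero (allSubsets n) (λ Z → g≡0 _ λ ())) ⟩
  g (outside ∷ A) + 0                                     ≡⟨ +-identityʳ _ ⟩
  g (outside ∷ A)                                         ∎
  where open ≡-Reasoning
∑-allSubsets-single {suc n} (inside ∷ A) g g≡0 = begin
  ∑ (allSubsets (suc n)) g                                ≡⟨ ∑-allSubsets-suc g ⟩
  ∑ (allSubsets n) (g ∘ (outside ∷_)) + ∑ (allSubsets n) (g ∘ (inside ∷_))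
    ≡⟨ cong₂ _+_ (∑-zero (allSubsets n) (λ Z → g≡0 _ λ ()))
                 (∑-allSubsets-single A _ (λ Z Z≢A → g≡0 _ (Z≢A ∘ ∷-injectiveʳ))) ⟩
  g (inside ∷ A)                                          ∎
  where open ≡-Reasoning

∑-⊆ : ∀ (U : Subset n) → ∑[ Z ∈ allSubsets n ] [ Z ⊆? U ] ≡ 2 ^ ∣ U ∣
∑-⊆ []            = refl
∑-⊆ {suc n} (outside ∷ U) = begin
  ∑ (allSubsets (suc n)) (λ Z → [ Z ⊆? outside ∷ U ])  ≡⟨ ∑-allSubsets-suc (λ Z → [ Z ⊆? outside ∷ U ]) ⟩
  ∑ (allSubsets n) (λ Z → [ Z ⊆? U ]) + ∑ (allSubsets n) (λ _ → 0)
    ≡⟨ cong₂ _+_ (∑-⊆ U) (∑-zero (allSubsets n) (λ _ → refl)) ⟩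
  2 ^ ∣ U ∣ + 0                                   ≡⟨ +-identityʳ _ ⟩
  2 ^ ∣ U ∣                                        ∎
  where open ≡-Reasoning
∑-⊆ {suc n} (inside ∷ U) = begin
  ∑ (allSubsets (suc n)) (λ Z → [ Z ⊆? inside ∷ U ])  ≡⟨ ∑-allSubsets-suc (λ Z → [ Z ⊆? inside ∷ U ]) ⟩
  ∑ (allSubsets n) (λ Z → [ Z ⊆? U ]) + ∑ (allSubsets n) (λ Z → [ Z ⊆? U ])  ≡⟨ cong (λ s → s + s) (∑-⊆ U) ⟩
  2 ^ ∣ U ∣ + 2 ^ ∣ U ∣                            ≡⟨ cong (_+_ (2 ^ ∣ U ∣)) (sym (+-identityʳ _)) ⟩
  2 ^ suc ∣ U ∣                                    ∎
  where open ≡-Reasoning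

-- Subsets of Fin n

∣p∣<∣q∣⇒p⊂q : ∀ {p q : Subset n} → p ⊆ q → ∣ p ∣ < ∣ q ∣ → p ⊂ q
∣p∣<∣q∣⇒p⊂q {p = outside ∷ p} {inside  ∷ q} p⊆q _ = p⊆q , zero , here , λ ()
∣p∣<∣q∣⇒p⊂q {p = inside  ∷ p} {outside ∷ q} p⊆q _ = contradiction (p⊆q here) λ ()
∣p∣<∣q∣⇒p⊂q {p = outside ∷ p} {outside ∷ q} p⊆q ∣p∣<∣q∣ = out⊂ (∣p∣<∣q∣⇒p⊂q (drop-∷-⊆ p⊆q) ∣p∣<∣q∣)
∣p∣<∣q∣⇒p⊂q {p = inside  ∷ p} {inside  ∷ q} p⊆q ∣p∣<∣q∣ = in⊂in (∣p∣<∣q∣⇒p⊂q (drop-∷-⊆ p⊆q) (≤-pred ∣p∣<∣q∣))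

p⊆q∧∣q∣≤∣p∣⇒p≡q : ∀ {p q : Subset n} → p ⊆ q → ∣ q ∣ ≤ ∣ p ∣ → p ≡ q
p⊆q∧∣q∣≤∣p∣⇒p≡q {p = p} p⊆q ∣q∣≤∣p∣ = ⊆-antisym p⊆q λ {x} x∈q →
  decidable-stable (x ∈? p) λ x∉p → <⇒≱ (p⊂q⇒∣p∣<∣q∣ (p⊆q , x , x∈q , x∉p)) ∣q∣≤∣p∣

∣p∪⁅x⁆∣≡1+∣p∣ : ∀ {p : Subset n} {x} → x ∉ p → ∣ p ∪ ⁅ x ⁆ ∣ ≡ suc ∣ p ∣
∣p∪⁅x⁆∣≡1+∣p∣ {p = outside ∷ p} {zero}  _   = cong (suc ∘ ∣_∣) (∪-identityʳ p)
∣p∪⁅x⁆∣≡1+∣p∣ {p = inside  ∷ p} {zero}  x∉p = contradiction here x∉p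
∣p∪⁅x⁆∣≡1+∣p∣ {p = outside ∷ p} {suc x} x∉p = ∣p∪⁅x⁆∣≡1+∣p∣ (x∉p ∘ there)
∣p∪⁅x⁆∣≡1+∣p∣ {p = inside  ∷ p} {suc x} x∉p = cong suc (∣p∪⁅x⁆∣≡1+∣p∣ (x∉p ∘ there))

p∪⁅x⁆⊆q⇔ : ∀ {p q : Subset n} {x} → p ∪ ⁅ x ⁆ ⊆ q ⇔ (p ⊆ q × x ∈ q)
p∪⁅x⁆⊆q⇔ {p = p} {q} {x} = mk⇔ split join
  where
  split : p ∪ ⁅ x ⁆ ⊆ q → p ⊆ q × x ∈ q
  split p∪x⊆q = (λ y∈p → p∪x⊆q (p⊆p∪q ⁅ x ⁆ y∈p)) , p∪x⊆q (q⊆p∪q p ⁅ x ⁆ (x∈⁅x⁆ x))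
  join : p ⊆ q × x ∈ q → p ∪ ⁅ x ⁆ ⊆ q
  join (p⊆q , x∈q) y∈p∪x =
    [ p⊆q , (λ y∈x → subst (_∈ q) (sym (x∈⁅y⁆⇒x≡y x y∈x)) x∈q) ]′ (x∈p∪q⁻ p ⁅ x ⁆ y∈p∪x)

p⊆q∧∣q∣≡1+∣p∣⇒q≡p∪⁅x⁆ : ∀ {p q : Subset n} → p ⊆ q → ∣ q ∣ ≡ suc ∣ p ∣ → ∃ λ x → q ≡ p ∪ ⁅ x ⁆
p⊆q∧∣q∣≡1+∣p∣⇒q≡p∪⁅x⁆ p⊆q ∣q∣≡ with ∣p∣<∣q∣⇒p⊂q p⊆q (≤-reflexive (sym ∣q∣≡))
... | _ , x , x∈q , x∉p = x , sym (p⊆q∧∣q∣≤∣p∣⇒p≡q (Equivalence.from p∪⁅x⁆⊆q⇔ (p⊆q , x∈q))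
                                    (≤-reflexive (trans ∣q∣≡ (sym (∣p∪⁅x⁆∣≡1+∣p∣ x∉p)))))

[w∩u]∪⁅x⁆≡w : ∀ {w u : Subset n} {x} → w ⊆ u ∪ ⁅ x ⁆ → x ∈ w → (w ∩ u) ∪ ⁅ x ⁆ ≡ w
[w∩u]∪⁅x⁆≡w {w = w} {u} {x} w⊆u∪x x∈w =
  ⊆-antisym (Equivalence.from p∪⁅x⁆⊆q⇔ ((λ y∈w∩u → proj₁ (x∈p∩q⁻ w u y∈w∩u)) , x∈w)) λ {y} y∈w →
    [ (λ y∈u → p⊆p∪q ⁅ x ⁆ (x∈p∩q⁺ (y∈w , y∈u))) , q⊆p∪q (w ∩ u) ⁅ x ⁆ ]′ (x∈p∪q⁻ u ⁅ x ⁆ (w⊆u∪x y∈w))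

w⊆u∪⁅x⁆∧x∉w⇒w⊆u : ∀ {w u : Subset n} {x} → w ⊆ u ∪ ⁅ x ⁆ → x ∉ w → w ⊆ u
w⊆u∪⁅x⁆∧x∉w⇒w⊆u {w = w} {u} {x} w⊆u∪x x∉w {y} y∈w =
  [ id , (λ y∈x → contradiction (subst (_∈ w) (x∈⁅y⁆⇒x≡y x y∈x) y∈w) x∉w) ]′ (x∈p∪q⁻ u ⁅ x ⁆ (w⊆u∪x y∈w))

∃⊆∧∣∣≡ : ∀ (p : Subset n) j → j ≤ ∣ p ∣ → ∃ λ s → s ⊆ p × ∣ s ∣ ≡ j
∃⊆∧∣∣≡ []            zero    _ = [] , id , refl
∃⊆∧∣∣≡ (outside ∷ p) j       j≤ with ∃⊆∧∣∣≡ p j j≤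
... | s , s⊆p , ∣s∣≡j = outside ∷ s , s⊆s s⊆p , ∣s∣≡j
∃⊆∧∣∣≡ {suc n} (inside ∷ p) zero _ = ∅ , ⊥⊆ , ∣⊥∣≡0 (suc n)
∃⊆∧∣∣≡ (inside  ∷ p) (suc j) j≤ with ∃⊆∧∣∣≡ p j (≤-pred j≤)
... | s , s⊆p , ∣s∣≡j = inside ∷ s , s⊆s s⊆p , cong suc ∣s∣≡j

∑-∪⁅⁆⊆ : ∀ (Z U : Subset n) → ∑[ x ∈ allFin n ] [ Z ∪ ⁅ x ⁆ ⊆? U ] ≡ [ Z ⊆? U ] * ∣ U ∣
∑-∪⁅⁆⊆ {n} Z U = begin
  ∑[ x ∈ allFin n ] [ Z ∪ ⁅ x ⁆ ⊆? U ]
    ≡⟨ ∑-cong (allFin n) (λ x → []-⇔× p∪⁅x⁆⊆q⇔ (Z ∪ ⁅ x ⁆ ⊆? U) (Z ⊆? U) (x ∈? U)) ⟩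
  ∑[ x ∈ allFin n ] ([ Z ⊆? U ] * [ x ∈? U ])   ≡⟨ *-distribˡ-∑ [ Z ⊆? U ] (allFin n) (λ x → [ x ∈? U ]) ⟨
  [ Z ⊆? U ] * (∑[ x ∈ allFin n ] [ x ∈? U ]) ≡⟨ cong ([ Z ⊆? U ] *_) (∑-∈ U) ⟩
  [ Z ⊆? U ] * ∣ U ∣                           ∎
  where open ≡-Reasoning

-- Degrees and double counting

infix 4 _≟ˢ_
_≟ˢ_ : DecidableEquality (Subset n)
_≟ˢ_ = ≡-dec _≟ᵇ_

degL : List (Subset n) → Subset n → ℕ
degL L W = ∑[ e ∈ L ] [ W ⊆? e ]

degM≡degL : ∀ (Y : List (Subset n)) S → degM Y S ≡ degL Y S
degM≡degL Y S = trans (length-filterᵇ≡∑ _ Y) (∑-cong Y λ e → cong ind (isYes≗does (S ⊆? e)))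

deg≡∑ : ∀ (H : Hypergraph n) S → deg H S ≡ ∑[ f ∈ allSubsets n ] ([ S ⊆? f ] * ind (H f))
deg≡∑ {n} H S = trans (length-filterᵇ≡∑ _ (allSubsets n)) (∑-cong (allSubsets n) λ f →
  trans (ind-∧ (H f) _) (trans (*-comm (ind (H f)) _) (cong (λ b → ind b * ind (H f)) (isYes≗does (S ⊆? f)))))

deg≤∑-links : ∀ (H : Hypergraph n) S → IsUniform (suc ∣ S ∣) H →
              deg H S ≤ ∑[ x ∈ allFin n ] ind (H (S ∪ ⁅ x ⁆))
deg≤∑-links {n} H S H-uniform = begin
  deg H S                                                              ≡⟨ deg≡∑ H S ⟩
  ∑[ f ∈ allSubsets n ] ([ S ⊆? f ] * ind (H f))                         ≤⟨ ∑-mono (allSubsets n) link ⟩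
  ∑[ f ∈ allSubsets n ] (∑[ x ∈ allFin n ] ([ f ≟ˢ S ∪ ⁅ x ⁆ ] * ind (H f)))
    ≡⟨ ∑-comm (allSubsets n) (allFin n) _ ⟩
  ∑[ x ∈ allFin n ] (∑[ f ∈ allSubsets n ] ([ f ≟ˢ S ∪ ⁅ x ⁆ ] * ind (H f)))
    ≡⟨ ∑-cong (allFin n) (λ x → ∑-allSubsets-single (S ∪ ⁅ x ⁆) _ λ f f≢ →
                                  cong (_* ind (H f)) ([]-no (f ≟ˢ _) f≢)) ⟩
  ∑[ x ∈ allFin n ] ([ S ∪ ⁅ x ⁆ ≟ˢ S ∪ ⁅ x ⁆ ] * ind (H (S ∪ ⁅ x ⁆)))
    ≡⟨ ∑-cong (allFin n) (λ x → trans (cong (_* ind (H (S ∪ ⁅ x ⁆))) ([]-yes (S ∪ ⁅ x ⁆ ≟ˢ S ∪ ⁅ x ⁆) refl))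
                                      (+-identityʳ _)) ⟩
  ∑[ x ∈ allFin n ] ind (H (S ∪ ⁅ x ⁆))                                ∎
  where
  open ≤-Reasoning
  link : ∀ f → [ S ⊆? f ] * ind (H f) ≤ ∑[ x ∈ allFin n ] ([ f ≟ˢ S ∪ ⁅ x ⁆ ] * ind (H f))
  link f with S ⊆? f | H f in Hf
  ... | no _    | _     = z≤n
  ... | yes _   | false = z≤n
  ... | yes S⊆f | true with p⊆q∧∣q∣≡1+∣p∣⇒q≡p∪⁅x⁆ S⊆f (H-uniform f Hf)
  ...   | x , f≡S∪x = ≤-trans (≤-reflexive (cong (_* 1) (sym ([]-yes (f ≟ˢ _) f≡S∪x))))
                              (∈⇒≤∑ (λ x → [ f ≟ˢ S ∪ ⁅ x ⁆ ] * 1) (∈-allFin x))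

deg-unionH : ∀ {m} (T : Fin m → Hypergraph n) S → deg (unionH T) S ≤ ∑[ i ∈ allFin m ] deg (T i) S
deg-unionH {n} {m} T S = begin
  deg (unionH T) S                                                   ≡⟨ deg≡∑ (unionH T) S ⟩
  ∑[ f ∈ allSubsets n ] ([ S ⊆? f ] * ind (unionH T f))
    ≤⟨ ∑-mono (allSubsets n) (λ f → *-monoʳ-≤ [ S ⊆? f ] (ind-any≤∑ (λ i → T i f) (allFin m))) ⟩
  ∑[ f ∈ allSubsets n ] ([ S ⊆? f ] * (∑[ i ∈ allFin m ] ind (T i f)))
    ≡⟨ ∑-cong (allSubsets n) (λ f → *-distribˡ-∑ [ S ⊆? f ] (allFin m) _) ⟩
  ∑[ f ∈ allSubsets n ] (∑[ i ∈ allFin m ] ([ S ⊆? f ] * ind (T i f)))  ≡⟨ ∑-comm (allSubsets n) (allFin m) _ ⟩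
  ∑[ i ∈ allFin m ] (∑[ f ∈ allSubsets n ] ([ S ⊆? f ] * ind (T i f)))  ≡⟨ ∑-cong (allFin m) (λ i → deg≡∑ (T i) S) ⟨
  ∑[ i ∈ allFin m ] deg (T i) S                                      ∎
  where open ≤-Reasoning

module _ {A : Set} (p : A → Bool) (d : A → ℕ) where

  foldr-⊔-≥ : ∀ {L a} → a ∈ₗ L → p a ≡ true → d a ≤ foldr _⊔_ 0 (map d (filterᵇ p L))
  foldr-⊔-≥ {b ∷ L} (Any.here refl) pb with p b
  ... | true = m≤m⊔n (d b) _
  foldr-⊔-≥ {b ∷ L} (Any.there a∈L) pa with p b
  ... | true  = ≤-trans (foldr-⊔-≥ a∈L pa) (m≤n⊔m (d b) _)
  ... | false = foldr-⊔-≥ a∈L pa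

  foldr-⊔-≤ : ∀ L {M} → (∀ a → p a ≡ true → d a ≤ M) → foldr _⊔_ 0 (map d (filterᵇ p L)) ≤ M
  foldr-⊔-≤ []      d≤M = z≤n
  foldr-⊔-≤ (a ∷ L) d≤M with p a in pa
  ... | true  = ⊔-lub (d≤M a pa) (foldr-⊔-≤ L d≤M)
  ... | false = foldr-⊔-≤ L d≤M

maxOver-≥ : ∀ r (d : Subset n → ℕ) S → ∣ S ∣ ≡ r ∸ 1 → d S ≤ maxOver r d
maxOver-≥ r d S ∣S∣≡ =
  foldr-⊔-≥ _ d (∈-allSubsets S) (trans (isYes≗does (∣ S ∣ ≟ r ∸ 1)) (dec-true (∣ S ∣ ≟ r ∸ 1) ∣S∣≡))

maxOver-lub : ∀ r (d : Subset n → ℕ) {M} → (∀ S → ∣ S ∣ ≡ r ∸ 1 → d S ≤ M) → maxOver r d ≤ M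
maxOver-lub {n} r d d≤M = foldr-⊔-≤ _ d (allSubsets n) λ S p →
  d≤M S (Equivalence.to (does≡true⇔ (∣ S ∣ ≟ r ∸ 1)) (trans (sym (isYes≗does (∣ S ∣ ≟ r ∸ 1))) p))

non-links-bound : ∀ (H : Hypergraph n) S q → IsUniform (suc ∣ S ∣) H → q * n ≤ q * deg H S + n →
                  q * (∑[ x ∈ allFin n ] ind (not (H (S ∪ ⁅ x ⁆)))) ≤ n
non-links-bound {n} H S q H-uniform dense = +-cancelʳ-≤ (q * E) (q * N) n (begin
  q * N + q * E    ≡⟨ *-distribˡ-+ q N E ⟨
  q * (N + E)      ≡⟨ cong (q *_) N+E≡n ⟩
  q * n            ≤⟨ dense ⟩
  q * deg H S + n  ≤⟨ +-monoˡ-≤ n (*-monoʳ-≤ q (deg≤∑-links H S H-uniform)) ⟩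
  q * E + n        ≡⟨ +-comm (q * E) n ⟩
  n + q * E        ∎)
  where
  open ≤-Reasoning
  N E : ℕ
  N = ∑[ x ∈ allFin n ] ind (not (H (S ∪ ⁅ x ⁆)))
  E = ∑[ x ∈ allFin n ] ind (H (S ∪ ⁅ x ⁆))
  N+E≡n : N + E ≡ n
  N+E≡n = begin-equality
    N + E                          ≡⟨ ∑-distrib-+ (allFin n) _ _ ⟨
    ∑[ x ∈ allFin n ] (ind (not (H (S ∪ ⁅ x ⁆))) + ind (H (S ∪ ⁅ x ⁆)))
                                   ≡⟨ ∑-cong (allFin n) (λ x → ind-not+ind (H (S ∪ ⁅ x ⁆))) ⟩
    ∑[ _ ∈ allFin n ] 1            ≡⟨ ∑-const (allFin n) 1 ⟩
    length (allFin n) * 1          ≡⟨ *-identityʳ _ ⟩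
    length (allFin n)              ≡⟨ length-allFin n ⟩
    n                              ∎

[⊆?]≤∑-links : ∀ (Z e : Subset n) → ∣ Z ∣ < ∣ e ∣ →
               [ Z ⊆? e ] ≤ ∑[ x ∈ allFin n ] ([ ¬? (x ∈? Z) ] * [ Z ∪ ⁅ x ⁆ ⊆? e ])
[⊆?]≤∑-links {n} Z e ∣Z∣<∣e∣ with Z ⊆? e
... | no _    = z≤n
... | yes Z⊆e with ∣p∣<∣q∣⇒p⊂q Z⊆e ∣Z∣<∣e∣
...   | _ , x , x∈e , x∉Z = ≤-trans
          (≤-reflexive (sym (cong₂ _*_ ([]-yes (¬? (x ∈? Z)) x∉Z)
                                       ([]-yes (Z ∪ ⁅ x ⁆ ⊆? e) (Equivalence.from p∪⁅x⁆⊆q⇔ (Z⊆e , x∈e))))))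
          (∈⇒≤∑ (λ x → [ ¬? (x ∈? Z) ] * [ Z ∪ ⁅ x ⁆ ⊆? e ]) (∈-allFin x))

degL-≤-pow : ∀ {s D} (L : List (Subset n)) → All (λ e → s < ∣ e ∣) L → (∀ S → ∣ S ∣ ≡ s → degL L S ≤ D) →
             ∀ d Z → ∣ Z ∣ + d ≡ s → degL L Z ≤ n ^ d * D
degL-≤-pow {n} {D = D} L large sparse zero Z ∣Z∣+0≡s =
  ≤-trans (sparse Z (trans (sym (+-identityʳ _)) ∣Z∣+0≡s)) (≤-reflexive (sym (+-identityʳ D)))
degL-≤-pow {n} {s} {D} L large sparse (suc d) Z ∣Z∣+d+1≡s = begin
  degL L Z
    ≤⟨ ∑-mono-∈ L (λ {e} e∈L → [⊆?]≤∑-links Z e (<-trans ∣Z∣<s (All.lookup large e∈L))) ⟩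
  ∑[ e ∈ L ] (∑[ x ∈ allFin n ] ([ ¬? (x ∈? Z) ] * [ Z ∪ ⁅ x ⁆ ⊆? e ]))
    ≡⟨ ∑-comm L (allFin n) (λ e x → [ ¬? (x ∈? Z) ] * [ Z ∪ ⁅ x ⁆ ⊆? e ]) ⟩
  ∑[ x ∈ allFin n ] (∑[ e ∈ L ] ([ ¬? (x ∈? Z) ] * [ Z ∪ ⁅ x ⁆ ⊆? e ]))
    ≡⟨ ∑-cong (allFin n) (λ x → *-distribˡ-∑ [ ¬? (x ∈? Z) ] L (λ e → [ Z ∪ ⁅ x ⁆ ⊆? e ])) ⟨
  ∑[ x ∈ allFin n ] ([ ¬? (x ∈? Z) ] * degL L (Z ∪ ⁅ x ⁆))
    ≤⟨ ∑-mono (allFin n) (λ x → []*-≤ (¬? (x ∈? Z)) (extend x)) ⟩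
  ∑[ _ ∈ allFin n ] (n ^ d * D)      ≡⟨ ∑-const (allFin n) (n ^ d * D) ⟩
  length (allFin n) * (n ^ d * D)    ≡⟨ cong (_* (n ^ d * D)) (length-allFin n) ⟩
  n * (n ^ d * D)                    ≡⟨ *-assoc n _ D ⟨
  n ^ suc d * D                      ∎
  where
  open ≤-Reasoning
  ∣Z∣<s : ∣ Z ∣ < s
  ∣Z∣<s = subst (suc ∣ Z ∣ ≤_) (trans (sym (+-suc ∣ Z ∣ d)) ∣Z∣+d+1≡s) (s≤s (m≤m+n ∣ Z ∣ d))
  extend : ∀ x → x ∉ Z → degL L (Z ∪ ⁅ x ⁆) ≤ n ^ d * D
  extend x x∉Z = degL-≤-pow L large sparse d (Z ∪ ⁅ x ⁆)
    (trans (cong (_+ d) (∣p∪⁅x⁆∣≡1+∣p∣ x∉Z)) (trans (sym (+-suc ∣ Z ∣ d)) ∣Z∣+d+1≡s))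

∑-degL-∪⁅⁆ : ∀ {K} (Us : List (Subset n)) → All (λ U → ∣ U ∣ ≤ K) Us → ∀ Z →
             ∑[ x ∈ allFin n ] degL Us (Z ∪ ⁅ x ⁆) ≤ K * degL Us Z
∑-degL-∪⁅⁆ {n} {K} [] [] Z = ≤-reflexive (trans (∑-zero (allFin n) (λ _ → refl)) (sym (*-zeroʳ K)))
∑-degL-∪⁅⁆ {n} {K} (U ∷ Us) (∣U∣≤K ∷ small) Z = begin
  ∑[ x ∈ allFin n ] ([ Z ∪ ⁅ x ⁆ ⊆? U ] + degL Us (Z ∪ ⁅ x ⁆))                  ≡⟨ ∑-distrib-+ (allFin n) _ _ ⟩
  ∑[ x ∈ allFin n ] [ Z ∪ ⁅ x ⁆ ⊆? U ] + ∑[ x ∈ allFin n ] degL Us (Z ∪ ⁅ x ⁆)    ≡⟨ cong (_+ _) (∑-∪⁅⁆⊆ Z U) ⟩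
  [ Z ⊆? U ] * ∣ U ∣ + ∑[ x ∈ allFin n ] degL Us (Z ∪ ⁅ x ⁆)
    ≤⟨ +-mono-≤ (*-monoʳ-≤ [ Z ⊆? U ] ∣U∣≤K) (∑-degL-∪⁅⁆ Us small Z) ⟩
  [ Z ⊆? U ] * K + K * degL Us Z                                                ≡⟨ cong (_+ K * degL Us Z) (*-comm [ Z ⊆? U ] K) ⟩
  K * [ Z ⊆? U ] + K * degL Us Z                                                ≡⟨ *-distribˡ-+ K _ _ ⟨
  K * degL (U ∷ Us) Z                                                           ∎
  where open ≤-Reasoning

-- The greedy packing

ε⁻¹ : ℕ → ℕ
ε⁻¹ K = 4 * 2 ^ K

budget : ℕ → ℕ → ℕ
budget K zero    = 0
budget K (suc j) = ε⁻¹ K * K * (budget K j + 1)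

γ⁻¹ : ℕ → ℕ → ℕ
γ⁻¹ r K = ε⁻¹ K * K * (budget K (r ∸ 1) + 1)

module Greedy {n r k h : ℕ} (G : Hypergraph n) (D : ℕ)
  (1≤r : 1 ≤ r) (r≤h : r ≤ h) (G-uniform : IsUniform r G) (2K<n : 2 * (k + h) < n)
  (G-dense : ∀ S → ∣ S ∣ ≡ r ∸ 1 → ε⁻¹ (k + h) * n ≤ ε⁻¹ (k + h) * deg G S + n)
  (D-small : γ⁻¹ r (k + h) * D ≤ n)
  where

  K : ℕ
  K = k + h

  threshold : ℕ → ℕ
  threshold j = budget K j * D * n ^ (r ∸ 1 ∸ j)

  -- cap r = 1 is what keeps the cliques edge-disjoint.
  cap : ℕ → ℕ
  cap j with j <? r
  ... | yes _ = threshold j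
  ... | no  _ = 1

  cap-< : ∀ {j} → j < r → cap j ≡ threshold j
  cap-< {j} j<r with j <? r
  ... | yes _   = refl
  ... | no  j≮r = contradiction j<r j≮r

  cap-≮ : ∀ {j} → ¬ j < r → cap j ≡ 1
  cap-≮ {j} j≮r with j <? r
  ... | yes j<r = contradiction j<r j≮r
  ... | no  _   = refl

  1+[r∸1]≡r : suc (r ∸ 1) ≡ r
  1+[r∸1]≡r = m+[n∸m]≡n 1≤r

  1≤n : 1 ≤ n
  1≤n = ≤-trans (s≤s z≤n) 2K<n

  1≤cap : 1 ≤ D → ∀ j → 1 ≤ cap (suc j)
  1≤cap 1≤D j with suc j <? r
  ... | no  _ = ≤-refl
  ... | yes _ = *-mono-≤ (*-mono-≤ 1≤budget 1≤D) (m^n>0 n {{>-nonZero 1≤n}} (r ∸ 1 ∸ suc j))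
    where
    1≤budget : 1 ≤ budget K (suc j)
    1≤budget = *-mono-≤ (*-mono-≤ (*-mono-≤ {1} {4} (s≤s z≤n) (m^n>0 2 K)) (≤-trans 1≤r (≤-trans r≤h (m≤n+m h k))))
                        (m≤n+m 1 (budget K j))

  cap-suc-bound : ∀ j → j < r → ε⁻¹ K * K * (threshold j + n ^ (r ∸ 1 ∸ j) * D) ≤ cap (suc j) * n
  cap-suc-bound j j<r with m≤n⇒m<n∨m≡n j<r
  ... | inj₁ 1+j<r = ≤-reflexive (begin
    ε⁻¹ K * K * (b * D * n ^ (r ∸ 1 ∸ j) + n ^ (r ∸ 1 ∸ j) * D)  ≡⟨ cong (λ e → ε⁻¹ K * K * (b * D * n ^ e + n ^ e * D)) r∸1∸j≡ ⟩
    ε⁻¹ K * K * (b * D * n ^ suc e + n ^ suc e * D)              ≡⟨ identity (ε⁻¹ K) K b D n (n ^ e) ⟩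
    threshold (suc j) * n                                              ≡⟨ cong (_* n) (cap-< 1+j<r) ⟨
    cap (suc j) * n                                              ∎)
    where
    open ≡-Reasoning
    b e : ℕ
    b = budget K j
    e = r ∸ 1 ∸ suc j
    r∸1∸j≡ : r ∸ 1 ∸ j ≡ suc e
    r∸1∸j≡ = +-∸-assoc 1 (∸-monoˡ-≤ 1 1+j<r)
    identity : ∀ q K b D n w → q * K * (b * D * (n * w) + n * w * D) ≡ q * K * (b + 1) * D * w * n
    identity = solve-∀
  ... | inj₂ 1+j≡r = begin
    ε⁻¹ K * K * (b * D * n ^ (r ∸ 1 ∸ j) + n ^ (r ∸ 1 ∸ j) * D)  ≡⟨ cong (λ e → ε⁻¹ K * K * (b * D * n ^ e + n ^ e * D)) r∸1∸j≡0 ⟩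
    ε⁻¹ K * K * (b * D * 1 + 1 * D)                              ≡⟨ identity (ε⁻¹ K) K b D ⟩
    ε⁻¹ K * K * (b + 1) * D                                      ≡⟨ cong (λ i → ε⁻¹ K * K * (budget K i + 1) * D) j≡r∸1 ⟩
    γ⁻¹ r K * D                                                  ≤⟨ D-small ⟩
    n                                                            ≡⟨ +-identityʳ n ⟨
    1 * n                                                        ≡⟨ cong (_* n) (cap-≮ (λ 1+j<r → <-irrefl 1+j≡r 1+j<r)) ⟨
    cap (suc j) * n                                              ∎
    where
    open ≤-Reasoning
    b : ℕ
    b = budget K j
    j≡r∸1 : j ≡ r ∸ 1
    j≡r∸1 = cong (_∸ 1) 1+j≡r
    r∸1∸j≡0 : r ∸ 1 ∸ j ≡ 0
    r∸1∸j≡0 = trans (cong (_∸ j) (sym j≡r∸1)) (n∸n≡0 j)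
    identity : ∀ q K b D → q * K * (b * D * 1 + 1 * D) ≡ q * K * (b + 1) * D
    identity = solve-∀

  Admissible : List (Subset n) → Subset n → Subset n → Set
  Admissible Us e U = ∀ W → W ⊆ U → ¬ W ⊆ e → ∣ W ∣ ≤ r → degL Us W < cap ∣ W ∣ × (∣ W ∣ ≡ r → G W ≡ true)

  module Extension
    (L Us : List (Subset n))
    (Us-small : All (λ U → ∣ U ∣ ≤ K) Us)
    (L-large : All (λ e → r ≤ ∣ e ∣) L)
    (L-sparse : ∀ S → ∣ S ∣ ≡ r ∸ 1 → degL L S ≤ D)
    (Us-sparse : ∀ W → ∣ W ∣ < r → degL Us W ≤ threshold ∣ W ∣ + degL L W)
    (1≤D : 1 ≤ D)
    where

    load : Subset n → ℕ
    load = degL Us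

    heavy-bound : ∀ Z → ∣ Z ∣ < r → ε⁻¹ K * (∑[ x ∈ allFin n ] [ cap (suc ∣ Z ∣) ≤? load (Z ∪ ⁅ x ⁆) ]) ≤ n
    heavy-bound Z ∣Z∣<r = *-cancelˡ-≤ t {{>-nonZero (1≤cap 1≤D j)}} (begin
      t * (ε⁻¹ K * c)                    ≡⟨ x∙yz≈y∙xz t (ε⁻¹ K) c ⟩
      ε⁻¹ K * (t * c)                    ≤⟨ *-monoʳ-≤ (ε⁻¹ K) t*c≤ ⟩
      ε⁻¹ K * (K * (threshold j + n ^ e * D))  ≡⟨ *-assoc (ε⁻¹ K) K _ ⟨
      ε⁻¹ K * K * (threshold j + n ^ e * D)    ≤⟨ cap-suc-bound j ∣Z∣<r ⟩
      t * n                              ∎)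
      where
      open ≤-Reasoning
      j e t c : ℕ
      j = ∣ Z ∣
      e = r ∸ 1 ∸ j
      t = cap (suc j)
      c = ∑[ x ∈ allFin n ] [ t ≤? load (Z ∪ ⁅ x ⁆) ]
      t*c≤ : t * c ≤ K * (threshold j + n ^ e * D)
      t*c≤ = begin
        t * c                                      ≡⟨ *-distribˡ-∑ t (allFin n) _ ⟩
        ∑[ x ∈ allFin n ] (t * [ t ≤? load (Z ∪ ⁅ x ⁆) ])  ≤⟨ ∑-mono (allFin n) (λ x → m*[m≤?n]≤n t _) ⟩
        ∑[ x ∈ allFin n ] load (Z ∪ ⁅ x ⁆)         ≤⟨ ∑-degL-∪⁅⁆ Us Us-small Z ⟩
        K * load Z                                 ≤⟨ *-monoʳ-≤ K (Us-sparse Z ∣Z∣<r) ⟩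
        K * (threshold j + degL L Z)                     ≤⟨ *-monoʳ-≤ K (+-monoʳ-≤ (threshold j) L-Z≤) ⟩
        K * (threshold j + n ^ e * D)                    ∎
        where
        L-Z≤ : degL L Z ≤ n ^ e * D
        L-Z≤ = degL-≤-pow L (All.map (λ r≤∣e∣ → ≤-trans (≤-reflexive 1+[r∸1]≡r) r≤∣e∣) L-large) L-sparse e Z
                 (m+[n∸m]≡n (≤-pred (≤-trans ∣Z∣<r (≤-reflexive (sym 1+[r∸1]≡r)))))

    badness : Subset n → Fin n → ℕ
    badness Z x = [ ∣ Z ∣ ≟ r ∸ 1 ] * ind (not (G (Z ∪ ⁅ x ⁆))) + [ ∣ Z ∣ <? r ] * [ cap (suc ∣ Z ∣) ≤? load (Z ∪ ⁅ x ⁆) ]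

    badness-bound : ∀ Z → 2 * 2 ^ K * (∑[ x ∈ allFin n ] badness Z x) ≤ n
    badness-bound Z = *-cancelˡ-≤ 2 (begin
      2 * (2 * 2 ^ K * ∑ (allFin n) (badness Z))                      ≡⟨ 4*p*s≡2*[2*p*s] (2 ^ K) _ ⟨
      ε⁻¹ K * ∑ (allFin n) (badness Z)                                ≡⟨ cong (ε⁻¹ K *_) split ⟩
      ε⁻¹ K * ([ ∣ Z ∣ ≟ r ∸ 1 ] * N + [ ∣ Z ∣ <? r ] * H)            ≡⟨ *-distribˡ-+ (ε⁻¹ K) _ _ ⟩
      ε⁻¹ K * ([ ∣ Z ∣ ≟ r ∸ 1 ] * N) + ε⁻¹ K * ([ ∣ Z ∣ <? r ] * H)
        ≡⟨ cong₂ _+_ (x∙yz≈y∙xz (ε⁻¹ K) [ ∣ Z ∣ ≟ r ∸ 1 ] N) (x∙yz≈y∙xz (ε⁻¹ K) [ ∣ Z ∣ <? r ] H) ⟩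
      [ ∣ Z ∣ ≟ r ∸ 1 ] * (ε⁻¹ K * N) + [ ∣ Z ∣ <? r ] * (ε⁻¹ K * H)  ≤⟨ +-mono-≤ ([]*-≤ (∣ Z ∣ ≟ r ∸ 1) non-edge-bound)
                                                                                  ([]*-≤ (∣ Z ∣ <? r) (heavy-bound Z)) ⟩
      n + n                                                           ≡⟨ cong (_+_ n) (+-identityʳ n) ⟨
      2 * n                                                           ∎)
      where
      open ≤-Reasoning
      4*p*s≡2*[2*p*s] : ∀ p s → 4 * p * s ≡ 2 * (2 * p * s)
      4*p*s≡2*[2*p*s] = solve-∀
      non-edge heavy : Fin n → ℕ
      non-edge x = ind (not (G (Z ∪ ⁅ x ⁆)))
      heavy x = [ cap (suc ∣ Z ∣) ≤? load (Z ∪ ⁅ x ⁆) ]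
      N H : ℕ
      N = ∑ (allFin n) non-edge
      H = ∑ (allFin n) heavy
      split : ∑ (allFin n) (badness Z) ≡ [ ∣ Z ∣ ≟ r ∸ 1 ] * N + [ ∣ Z ∣ <? r ] * H
      split = trans (∑-distrib-+ (allFin n) _ _) (sym (cong₂ _+_
        (*-distribˡ-∑ [ ∣ Z ∣ ≟ r ∸ 1 ] (allFin n) non-edge) (*-distribˡ-∑ [ ∣ Z ∣ <? r ] (allFin n) heavy)))
      non-edge-bound : ∣ Z ∣ ≡ r ∸ 1 → ε⁻¹ K * N ≤ n
      non-edge-bound ∣Z∣≡ = non-links-bound G Z (ε⁻¹ K)
        (subst (λ m → IsUniform m G) (sym (trans (cong suc ∣Z∣≡) 1+[r∸1]≡r)) G-uniform) (G-dense Z ∣Z∣≡)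

    obstruction : Subset n → Fin n → ℕ
    obstruction U x = [ x ∈? U ] + ∑[ Z ∈ allSubsets n ] ([ Z ⊆? U ] * badness Z x)

    obstruction-total : ∀ U → ∣ U ∣ < K → ∑[ x ∈ allFin n ] obstruction U x < n
    obstruction-total U ∣U∣<K = *-cancelˡ-< 2 _ n (begin-strict
      2 * ∑ (allFin n) (obstruction U)    ≡⟨ cong (2 *_) total≡ ⟩
      2 * (∣ U ∣ + B)                     ≡⟨ *-distribˡ-+ 2 ∣ U ∣ B ⟩
      2 * ∣ U ∣ + 2 * B                   <⟨ +-mono-<-≤ (<-trans (*-monoʳ-< 2 ∣U∣<K) 2K<n) 2B≤n ⟩
      n + n                               ≡⟨ cong (_+_ n) (+-identityʳ n) ⟨
      2 * n                               ∎)
      where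
      open ≤-Reasoning
      b : Subset n → ℕ
      b Z = ∑ (allFin n) (badness Z)
      B : ℕ
      B = ∑[ Z ∈ allSubsets n ] ([ Z ⊆? U ] * b Z)
      total≡ : ∑ (allFin n) (obstruction U) ≡ ∣ U ∣ + B
      total≡ = begin-equality
        ∑ (allFin n) (obstruction U)                                              ≡⟨ ∑-distrib-+ (allFin n) _ _ ⟩
        ∑[ x ∈ allFin n ] [ x ∈? U ] + ∑[ x ∈ allFin n ] (∑[ Z ∈ allSubsets n ] ([ Z ⊆? U ] * badness Z x))
          ≡⟨ cong₂ _+_ (∑-∈ U) (∑-comm (allFin n) (allSubsets n) _) ⟩
        ∣ U ∣ + ∑[ Z ∈ allSubsets n ] (∑[ x ∈ allFin n ] ([ Z ⊆? U ] * badness Z x))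
          ≡⟨ cong (_+_ (∣ U ∣)) (∑-cong (allSubsets n) (λ Z → *-distribˡ-∑ [ Z ⊆? U ] (allFin n) (badness Z))) ⟨
        ∣ U ∣ + B                                                                 ∎
      2B≤n : 2 * B ≤ n
      2B≤n = *-cancelˡ-≤ (2 ^ K) {{m^n≢0 2 K}} (begin
        2 ^ K * (2 * B)                                          ≡⟨ x∙yz≈y∙xz (2 ^ K) 2 B ⟩
        2 * (2 ^ K * B)                                          ≡⟨ *-assoc 2 (2 ^ K) B ⟨
        2 * 2 ^ K * B                                            ≡⟨ *-distribˡ-∑ (2 * 2 ^ K) (allSubsets n) _ ⟩
        ∑[ Z ∈ allSubsets n ] (2 * 2 ^ K * ([ Z ⊆? U ] * b Z))
          ≡⟨ ∑-cong (allSubsets n) (λ Z → x∙yz≈y∙xz (2 * 2 ^ K) [ Z ⊆? U ] (b Z)) ⟩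
        ∑[ Z ∈ allSubsets n ] ([ Z ⊆? U ] * (2 * 2 ^ K * b Z))
          ≤⟨ ∑-mono (allSubsets n) (λ Z → *-monoʳ-≤ [ Z ⊆? U ] (badness-bound Z)) ⟩
        ∑[ Z ∈ allSubsets n ] ([ Z ⊆? U ] * n)                   ≡⟨ ∑-cong (allSubsets n) (λ Z → *-comm [ Z ⊆? U ] n) ⟩
        ∑[ Z ∈ allSubsets n ] (n * [ Z ⊆? U ])                   ≡⟨ *-distribˡ-∑ n (allSubsets n) _ ⟨
        n * ∑[ Z ∈ allSubsets n ] [ Z ⊆? U ]                     ≡⟨ cong (n *_) (∑-⊆ U) ⟩
        n * 2 ^ ∣ U ∣                                            ≤⟨ *-monoʳ-≤ n (^-monoʳ-≤ 2 (<⇒≤ ∣U∣<K)) ⟩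
        n * 2 ^ K                                                ≡⟨ *-comm n (2 ^ K) ⟩
        2 ^ K * n                                                ∎)

    Addable : Subset n → Fin n → Set
    Addable U x = ∀ Z → Z ⊆ U →
      (∣ Z ∣ ≡ r ∸ 1 → G (Z ∪ ⁅ x ⁆) ≡ true) × (∣ Z ∣ < r → load (Z ∪ ⁅ x ⁆) < cap (suc ∣ Z ∣))

    obstruction≡0⇒ : ∀ U x → obstruction U x ≡ 0 → x ∉ U × Addable U x
    obstruction≡0⇒ U x obstruction≡0 = []≡0⇒¬ (x ∈? U) (m+n≡0⇒m≡0 _ obstruction≡0) , addable
      where
      addable : Addable U x
      addable Z Z⊆U =
        (λ ∣Z∣≡ → ind-not≡0⇒ ([]*≡0⇒ (∣ Z ∣ ≟ r ∸ 1) (m+n≡0⇒m≡0 _ badness≡0) ∣Z∣≡)) ,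
        (λ ∣Z∣<r → ≰⇒> ([]≡0⇒¬ (cap (suc ∣ Z ∣) ≤? load (Z ∪ ⁅ x ⁆))
                                ([]*≡0⇒ (∣ Z ∣ <? r) (m+n≡0⇒n≡0 _ badness≡0) ∣Z∣<r)))
        where
        badness≡0 : badness Z x ≡ 0
        badness≡0 = []*≡0⇒ (Z ⊆? U)
          (n≤0⇒n≡0 (≤-trans (∈⇒≤∑ (λ Z → [ Z ⊆? U ] * badness Z x) (∈-allSubsets Z))
                            (≤-reflexive (m+n≡0⇒n≡0 [ x ∈? U ] obstruction≡0))))
          Z⊆U

    admissible-∪⁅⁆ : ∀ {e U x} → Admissible Us e U → x ∉ U → Addable U x → Admissible Us e (U ∪ ⁅ x ⁆)
    admissible-∪⁅⁆ {e} {U} {x} admissible x∉U addable W W⊆U∪x W⊈e ∣W∣≤r with x ∈? W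
    ... | no  x∉W = admissible W (w⊆u∪⁅x⁆∧x∉w⇒w⊆u W⊆U∪x x∉W) W⊈e ∣W∣≤r
    ... | yes x∈W = subst (λ V → load V < cap ∣ V ∣ × (∣ V ∣ ≡ r → G V ≡ true)) ([w∩u]∪⁅x⁆≡w W⊆U∪x x∈W)
                          (subst (λ m → load (Z ∪ ⁅ x ⁆) < cap m) (sym ∣Z∪x∣≡) (light ∣Z∣<r) ,
                           λ ∣Z∪x∣≡r → inG (cong (_∸ 1) (trans (sym ∣Z∪x∣≡) ∣Z∪x∣≡r)))
      where
      Z : Subset n
      Z = W ∩ U
      Z⊆U : Z ⊆ U
      Z⊆U y∈Z = proj₂ (x∈p∩q⁻ W U y∈Z)
      ∣Z∪x∣≡ : ∣ Z ∪ ⁅ x ⁆ ∣ ≡ suc ∣ Z ∣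
      ∣Z∪x∣≡ = ∣p∪⁅x⁆∣≡1+∣p∣ (x∉U ∘ Z⊆U)
      ∣Z∣<r : ∣ Z ∣ < r
      ∣Z∣<r = ≤-trans (≤-reflexive (trans (sym ∣Z∪x∣≡) (cong ∣_∣ ([w∩u]∪⁅x⁆≡w W⊆U∪x x∈W)))) ∣W∣≤r
      inG = proj₁ (addable Z Z⊆U)
      light = proj₂ (addable Z Z⊆U)

    extend : ∀ e → ∣ e ∣ ≤ h → ∀ m → m ≤ k → ∃ λ U → e ⊆ U × ∣ U ∣ ≡ m + ∣ e ∣ × Admissible Us e U
    extend e ∣e∣≤h zero    _   = e , (λ x∈e → x∈e) , refl , λ W W⊆e W⊈e _ → contradiction (λ {y} → W⊆e {y}) W⊈e
    extend e ∣e∣≤h (suc m) m<k with extend e ∣e∣≤h m (<⇒≤ m<k)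
    ... | U , e⊆U , ∣U∣≡ , admissible
        with ∑<length⇒∃≡0 (allFin n) (obstruction U)
               (subst (∑ (allFin n) (obstruction U) <_) (sym (length-allFin n))
                 (obstruction-total U (subst (_< K) (sym ∣U∣≡) (+-mono-<-≤ m<k ∣e∣≤h))))
    ...   | x , obstruction≡0 with obstruction≡0⇒ U x obstruction≡0
    ...     | x∉U , addable =
      U ∪ ⁅ x ⁆ , (λ y∈e → p⊆p∪q ⁅ x ⁆ (e⊆U y∈e)) , trans (∣p∪⁅x⁆∣≡1+∣p∣ x∉U) (cong suc ∣U∣≡) ,
      admissible-∪⁅⁆ admissible x∉U addable

  PartialEdge : Subset n → Subset n → Subset n → Set
  PartialEdge e U f = ∣ f ∣ ≡ r × f ⊆ U × ¬ f ⊆ e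

  record Packing (L : List (Subset n)) (Us : Fin (length L) → Subset n) : Set where
    field
      e⊆U      : ∀ i → lookup L i ⊆ Us i
      ∣U∣≡     : ∀ i → ∣ Us i ∣ ≡ k + ∣ lookup L i ∣
      inG      : ∀ i f → PartialEdge (lookup L i) (Us i) f → G f ≡ true
      disjoint : ∀ i j → i ≢ j → ∀ f → PartialEdge (lookup L i) (Us i) f → PartialEdge (lookup L j) (Us j) f → ⊥
      sparse   : ∀ W → ∣ W ∣ < r → degL (tabulate Us) W ≤ threshold ∣ W ∣ + degL L W

  packing-small : ∀ {L Us} → Packing L Us → All (λ e → ∣ e ∣ ≤ h) L → ∀ i → ∣ Us i ∣ ≤ K
  packing-small P L-small i = ≤-trans (≤-reflexive (Packing.∣U∣≡ P i)) (+-monoʳ-≤ k (All.lookup L-small (∈-lookup i)))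

  packing-∷ : ∀ {L Us e U} → Packing L Us → e ⊆ U × ∣ U ∣ ≡ k + ∣ e ∣ × Admissible (tabulate Us) e U →
              Packing (e ∷ L) (U Vector.∷ Us)
  packing-∷ {L} {Us} {e} {U} P (e⊆U , ∣U∣≡ , admissible) = record
    { e⊆U      = λ { zero → e⊆U ; (suc i) → Packing.e⊆U P i }
    ; ∣U∣≡     = λ { zero → ∣U∣≡ ; (suc i) → Packing.∣U∣≡ P i }
    ; inG      = λ { zero f (∣f∣≡r , f⊆U , f⊈e) → proj₂ (admissible f f⊆U f⊈e (≤-reflexive ∣f∣≡r)) ∣f∣≡r
                   ; (suc i) → Packing.inG P i }
    ; disjoint = disjoint
    ; sparse   = sparse
    }
    where
    unused : ∀ {f} → PartialEdge e U f → ∀ j → ¬ f ⊆ Us j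
    unused {f} (∣f∣≡r , f⊆U , f⊈e) j f⊆Uj = <⇒≱ load<1 1≤load
      where
      load<1 : degL (tabulate Us) f < 1
      load<1 = subst (degL (tabulate Us) f <_) (trans (cong cap ∣f∣≡r) (cap-≮ (n≮n r)))
                 (proj₁ (admissible f f⊆U f⊈e (≤-reflexive ∣f∣≡r)))
      1≤load : 1 ≤ degL (tabulate Us) f
      1≤load = ≤-trans (≤-reflexive (sym ([]-yes (f ⊆? Us j) f⊆Uj))) (∈⇒≤∑ (λ V → [ f ⊆? V ]) (∈-tabulate⁺ j))
    disjoint : ∀ i j → i ≢ j → ∀ f → PartialEdge (lookup (e ∷ L) i) ((U Vector.∷ Us) i) f →
               PartialEdge (lookup (e ∷ L) j) ((U Vector.∷ Us) j) f → ⊥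
    disjoint zero    zero    i≢j = contradiction refl i≢j
    disjoint zero    (suc j) _   f new (_ , f⊆Uj , _) = unused new j f⊆Uj
    disjoint (suc i) zero    _   f (_ , f⊆Ui , _) new = unused new i f⊆Ui
    disjoint (suc i) (suc j) i≢j = Packing.disjoint P i j (i≢j ∘ cong suc)
    sparse : ∀ W → ∣ W ∣ < r → [ W ⊆? U ] + degL (tabulate Us) W ≤ threshold ∣ W ∣ + ([ W ⊆? e ] + degL L W)
    sparse W ∣W∣<r with Packing.sparse P W ∣W∣<r | W ⊆? e | W ⊆? U
    ... | old | yes _   | yes _   = ≤-trans (s≤s old) (≤-reflexive (sym (+-suc _ _)))
    ... | old | yes _   | no  _   = ≤-trans old (+-monoʳ-≤ (threshold ∣ W ∣) (n≤1+n _))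
    ... | old | no  _   | no  _   = old
    ... | old | no  W⊈e | yes W⊆U = ≤-trans light (m≤m+n _ _)
      where
      light : suc (degL (tabulate Us) W) ≤ threshold ∣ W ∣
      light = subst (degL (tabulate Us) W <_) (cap-< ∣W∣<r) (proj₁ (admissible W W⊆U W⊈e (<⇒≤ ∣W∣<r)))

  pack : ∀ L → All (λ e → r ≤ ∣ e ∣ × ∣ e ∣ ≤ h) L → (∀ S → ∣ S ∣ ≡ r ∸ 1 → degL L S ≤ D) →
         Σ (Fin (length L) → Subset n) (Packing L)
  pack [] _ _ = (λ ()) , record { e⊆U = λ () ; ∣U∣≡ = λ () ; inG = λ () ; disjoint = λ () ; sparse = λ _ _ → z≤n }
  pack (e ∷ L) ((r≤∣e∣ , ∣e∣≤h) ∷ bounds) eL-sparse =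
    proj₁ new Vector.∷ Us , packing-∷ P (proj₂ new)
    where
    L-sparse : ∀ S → ∣ S ∣ ≡ r ∸ 1 → degL L S ≤ D
    L-sparse S ∣S∣≡ = ≤-trans (m≤n+m _ [ S ⊆? e ]) (eL-sparse S ∣S∣≡)
    Us = proj₁ (pack L bounds L-sparse)
    P  = proj₂ (pack L bounds L-sparse)
    1≤D : 1 ≤ D
    1≤D with ∃⊆∧∣∣≡ e (r ∸ 1) (≤-trans (m∸n≤m r 1) r≤∣e∣)
    ... | S , S⊆e , ∣S∣≡ = ≤-trans (≤-trans (≤-reflexive (sym ([]-yes (S ⊆? e) S⊆e))) (m≤m+n _ _)) (eL-sparse S ∣S∣≡)
    Us-small : All (λ U → ∣ U ∣ ≤ K) (tabulate Us)
    Us-small = tabulate⁺ (packing-small P (All.map proj₂ bounds))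
    open Extension L (tabulate Us) Us-small (All.map proj₁ bounds) L-sparse (Packing.sparse P) 1≤D
    new = extend e ∣e∣≤h k ≤-refl

  partialEdge? : ∀ e U f → Dec (PartialEdge e U f)
  partialEdge? e U f = ∣ f ∣ ≟ r ×-dec f ⊆? U ×-dec ¬? (f ⊆? e)

  cliques : (L : List (Subset n)) → (Fin (length L) → Subset n) → Fin (length L) → Hypergraph n
  cliques L Us i f = does (partialEdge? (lookup L i) (Us i) f)

  clique⇒partialEdge : ∀ L Us i f → cliques L Us i f ≡ true → PartialEdge (lookup L i) (Us i) f
  clique⇒partialEdge L Us i f = Equivalence.to (does≡true⇔ (partialEdge? (lookup L i) (Us i) f))

  module _ {L Us} (P : Packing L Us) (L-small : All (λ e → ∣ e ∣ ≤ h) L) where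

    open Packing P

    cliques-partialK : ∀ i → IsPartialK G r (lookup L i) (k + ∣ lookup L i ∣) (cliques L Us i)
    cliques-partialK i = Us i , e⊆U i , ∣U∣≡ i , (λ f → does≡true⇔ (partialEdge? _ _ f)) ,
                         λ f → inG i f ∘ clique⇒partialEdge L Us i f

    cliques-disjoint : ∀ i j → i ≢ j → ∀ f → cliques L Us i f ≡ true → cliques L Us j f ≡ true → ⊥
    cliques-disjoint i j i≢j f Ti Tj =
      disjoint i j i≢j f (clique⇒partialEdge L Us i f Ti) (clique⇒partialEdge L Us j f Tj)

    deg-cliques : ∀ i S → ∣ S ∣ ≡ r ∸ 1 → deg (cliques L Us i) S ≤ K * [ S ⊆? Us i ]
    deg-cliques i S ∣S∣≡ = begin
      deg (cliques L Us i) S                               ≤⟨ deg≤∑-links (cliques L Us i) S uniform ⟩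
      ∑[ x ∈ allFin n ] ind (cliques L Us i (S ∪ ⁅ x ⁆))
        ≤⟨ ∑-mono (allFin n) (λ x → []-mono (partialEdge? _ _ _) (S ∪ ⁅ x ⁆ ⊆? Us i) (proj₁ ∘ proj₂)) ⟩
      ∑[ x ∈ allFin n ] [ S ∪ ⁅ x ⁆ ⊆? Us i ]              ≡⟨ ∑-∪⁅⁆⊆ S (Us i) ⟩
      [ S ⊆? Us i ] * ∣ Us i ∣                             ≤⟨ *-monoʳ-≤ [ S ⊆? Us i ] (packing-small P L-small i) ⟩
      [ S ⊆? Us i ] * K                                    ≡⟨ *-comm [ S ⊆? Us i ] K ⟩
      K * [ S ⊆? Us i ]                                    ∎
      where
      open ≤-Reasoning
      uniform : IsUniform (suc ∣ S ∣) (cliques L Us i)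
      uniform f T≡ = trans (proj₁ (clique⇒partialEdge L Us i f T≡)) (sym (trans (cong suc ∣S∣≡) 1+[r∸1]≡r))

    Δ-cliques : (∀ S → ∣ S ∣ ≡ r ∸ 1 → degL L S ≤ D) →
                Δ r (unionH (cliques L Us)) ≤ K * (budget K (r ∸ 1) + 1) * D
    Δ-cliques L-sparse = maxOver-lub r (deg (unionH (cliques L Us))) λ S ∣S∣≡ → begin
      deg (unionH (cliques L Us)) S                ≤⟨ deg-unionH (cliques L Us) S ⟩
      ∑[ i ∈ allFin (length L) ] deg (cliques L Us i) S  ≤⟨ ∑-mono (allFin (length L)) (λ i → deg-cliques i S ∣S∣≡) ⟩
      ∑[ i ∈ allFin (length L) ] (K * [ S ⊆? Us i ])    ≡⟨ *-distribˡ-∑ K (allFin (length L)) _ ⟨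
      K * ∑[ i ∈ allFin (length L) ] [ S ⊆? Us i ]      ≡⟨ cong (K *_) (∑-tabulate Us (λ U → [ S ⊆? U ])) ⟨
      K * degL (tabulate Us) S
        ≤⟨ *-monoʳ-≤ K (sparse S (≤-trans (s≤s (≤-reflexive ∣S∣≡)) (≤-reflexive 1+[r∸1]≡r))) ⟩
      K * (threshold ∣ S ∣ + degL L S)                   ≤⟨ *-monoʳ-≤ K (+-monoʳ-≤ (threshold ∣ S ∣) (L-sparse S ∣S∣≡)) ⟩
      K * (threshold ∣ S ∣ + D)                          ≡⟨ cong (λ j → K * (threshold j + D)) ∣S∣≡ ⟩
      K * (budget K (r ∸ 1) * D * n ^ (r ∸ 1 ∸ (r ∸ 1)) + D)
        ≡⟨ cong (λ e → K * (budget K (r ∸ 1) * D * n ^ e + D)) (n∸n≡0 (r ∸ 1)) ⟩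
      K * (budget K (r ∸ 1) * D * 1 + D)           ≡⟨ identity K (budget K (r ∸ 1)) D ⟩
      K * (budget K (r ∸ 1) + 1) * D               ∎
      where
      open ≤-Reasoning
      identity : ∀ K b D → K * (b * D * 1 + D) ≡ K * (b + 1) * D
      identity = solve-∀

-- The rational constants

-- Imported only here: with the prefix +_ in scope, 2 ^ ∣ U ∣ + 2 ^ ∣ U ∣ no longer parses.
open import Data.Integer using (+_)

-- fromℚᵘ (mkℚᵘ a d) computes to a / suc d.
toℚᵘ-/ : ∀ a d → toℚᵘ (+ a / suc d) ≃ mkℚᵘ (+ a) d
toℚᵘ-/ a d = toℚᵘ-fromℚᵘ (mkℚᵘ (+ a) d)

toℚᵘ-[1-1/q]*a : ∀ q a → toℚᵘ ((1ℚ - + 1 / suc q) *ℚ (+ a / 1)) ≃ (mkℚᵘ (+ 1) 0 ℚᵘ.- mkℚᵘ (+ 1) q) ℚᵘ.* mkℚᵘ (+ a) 0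
toℚᵘ-[1-1/q]*a q a = ℚᵘP.≃-trans (toℚᵘ-homo-* (1ℚ - + 1 / suc q) (+ a / 1)) (ℚᵘP.*-cong
  (ℚᵘP.≃-trans (toℚᵘ-homo-+ 1ℚ (ℚ.- (+ 1 / suc q)))
    (ℚᵘP.+-cong (ℚᵘP.≃-refl {mkℚᵘ (+ 1) 0}) (ℚᵘP.≃-trans (toℚᵘ-homo‿- (+ 1 / suc q)) (ℚᵘP.-‿cong (toℚᵘ-/ 1 q)))))
  (toℚᵘ-/ a 0))

toℚᵘ-[1/q]*a : ∀ q a → toℚᵘ ((+ 1 / suc q) *ℚ (+ a / 1)) ≃ mkℚᵘ (+ 1) q ℚᵘ.* mkℚᵘ (+ a) 0
toℚᵘ-[1/q]*a q a = ℚᵘP.≃-trans (toℚᵘ-homo-* (+ 1 / suc q) (+ a / 1)) (ℚᵘP.*-cong (toℚᵘ-/ 1 q) (toℚᵘ-/ a 0))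

[1-1/q]a≤b⇒qa≤qb+a : ∀ q .{{_ : NonZero q}} a b → (1ℚ - + 1 / q) *ℚ (+ a / 1) ≤ℚ + b / 1 → q * a ≤ q * b + a
[1-1/q]a≤b⇒qa≤qb+a (suc q) a b H with ℚᵘP.≤-respʳ-≃ (toℚᵘ-/ b 0) (ℚᵘP.≤-respˡ-≃ (toℚᵘ-[1-1/q]*a q a) (toℚᵘ-mono-≤ H))
... | *≤* qa-a≤bq = ℤP.drop‿+≤+ (begin
  -- qa-a≤bq is the cross-multiplied inequality as ℚᵘ._≤_ unfolds; it fixes the shape of the middle terms
  + (suc q * a)                                                        ≡⟨ ℤP.pos-* (suc q) a ⟩
  + suc q ℤ.* + a                                                      ≡⟨ lhs (+ suc q) (+ a) ⟩
  ((+ 1 ℤ.* + suc q ℤ.+ ℤ.- + 1 ℤ.* + 1) ℤ.* + a) ℤ.* + 1 ℤ.+ + a      ≤⟨ ℤP.+-monoˡ-≤ (+ a) qa-a≤bq ⟩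
  + b ℤ.* + (1 * suc q * 1) ℤ.+ + a
    ≡⟨ cong (λ m → + b ℤ.* + m ℤ.+ + a) (trans (*-identityʳ _) (*-identityˡ _)) ⟩
  + b ℤ.* + suc q ℤ.+ + a
    ≡⟨ cong (ℤ._+ + a) (trans (ℤP.*-comm (+ b) (+ suc q)) (sym (ℤP.pos-* (suc q) b))) ⟩
  + (suc q * b) ℤ.+ + a                                                ≡⟨ ℤP.pos-+ (suc q * b) a ⟨
  + (suc q * b + a)                                                    ∎)
  where
  open ℤP.≤-Reasoning
  lhs : ∀ x y → x ℤ.* y ≡ ((+ 1 ℤ.* x ℤ.+ ℤ.- + 1 ℤ.* + 1) ℤ.* y) ℤ.* + 1 ℤ.+ y
  lhs = ℤ-Ring.solve-∀

b≤[1/q]a⇒qb≤a : ∀ q .{{_ : NonZero q}} a b → + b / 1 ≤ℚ (+ 1 / q) *ℚ (+ a / 1) → q * b ≤ a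
b≤[1/q]a⇒qb≤a (suc q) a b H with ℚᵘP.≤-respʳ-≃ (toℚᵘ-[1/q]*a q a) (ℚᵘP.≤-respˡ-≃ (toℚᵘ-/ b 0) (toℚᵘ-mono-≤ H))
... | *≤* bq≤a = ℤP.drop‿+≤+ (begin
  + (suc q * b)                     ≡⟨ cong +_ (*-comm (suc q) b) ⟩
  + (b * suc q)                     ≡⟨ cong (λ m → + (b * m)) (*-identityʳ (suc q)) ⟨
  + (b * (suc q * 1))               ≡⟨ ℤP.pos-* b (suc q * 1) ⟩
  + b ℤ.* + (suc q * 1)             ≤⟨ bq≤a ⟩
  (+ 1 ℤ.* + a) ℤ.* + 1             ≡⟨ trans (ℤP.*-identityʳ _) (ℤP.*-identityˡ _) ⟩
  + a                               ∎)
  where open ℤP.≤-Reasoning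

0<1/q : ∀ q .{{_ : NonZero q}} → 0ℚ <ℚ + 1 / q
0<1/q q = positive⁻¹ (+ 1 / q) {{normalize-pos 1 q}}

1/q<1 : ∀ q .{{_ : NonZero q}} → 1 < q → + 1 / q <ℚ 1ℚ
1/q<1 (suc zero)    (s≤s ())
1/q<1 (suc (suc q)) _ = toℚᵘ-cancel-< (ℚᵘP.<-respˡ-≃ (ℚᵘP.≃-sym (toℚᵘ-/ 1 (suc q))) (*<* (+<+ (s≤s (s≤s z≤n)))))

lemma5p2 : (h r k : ℕ) → 1 ≤ r → r ≤ h → 1 ≤ k →
    Σ ℕ λ C → Σ ℚ λ ε → Σ ℚ λ γ →
      1 ≤ C × (0ℚ <ℚ ε) × (ε <ℚ 1ℚ) × (0ℚ <ℚ γ) × (γ <ℚ 1ℚ) ×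
      ((n : ℕ) (G : Hypergraph n) → IsUniform r G → C ≤ n →
        (∀ (S : Subset n) → ∣ S ∣ ≡ r ∸ 1 → (1ℚ - ε) *ℚ (+ n / 1) ≤ℚ (+ deg G S / 1)) →
        (Y : List (Subset n)) →
        All (λ e → ∣ e ∣ ≤ h) Y →
        All (λ e → G e ≡ false) Y →
        (+ Δmulti r Y / 1) ≤ℚ γ *ℚ (+ n / 1) →
        All (λ e → r ≤ ∣ e ∣) Y →
        Σ (Fin (length Y) → Hypergraph n) λ T →
          (∀ i → IsPartialK G r (lookup Y i) (k + ∣ lookup Y i ∣) (T i))
          × (∀ i j → i ≢ j → ∀ f → T i f ≡ true → T j f ≡ true → ⊥)
          × Δ r (unionH T) ≤ C * Δmulti r Y)
lemma5p2 h r k 1≤r r≤h _ =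
  C , + 1 / ε⁻¹ K , + 1 / γ⁻¹ r K , s≤s z≤n ,
  0<1/q (ε⁻¹ K) , 1/q<1 (ε⁻¹ K) 1<ε⁻¹ , 0<1/q (γ⁻¹ r K) , 1/q<1 (γ⁻¹ r K) 1<γ⁻¹ ,
  λ n G G-uniform C≤n G-dense Y Y-small _ Y-sparse Y-large →
    let open Greedy {k = k} G (Δmulti r Y) 1≤r r≤h G-uniform (≤-trans (s≤s (m≤m+n (2 * K) _)) C≤n)
                     (λ S ∣S∣≡ → [1-1/q]a≤b⇒qa≤qb+a (ε⁻¹ K) n (deg G S) (G-dense S ∣S∣≡))
                     (b≤[1/q]a⇒qb≤a (γ⁻¹ r K) n _ Y-sparse)
                     using (pack; cliques; cliques-partialK; cliques-disjoint; Δ-cliques)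
        Y-maxDeg : ∀ S → ∣ S ∣ ≡ r ∸ 1 → degL Y S ≤ Δmulti r Y
        Y-maxDeg S ∣S∣≡ = subst (_≤ Δmulti r Y) (degM≡degL Y S) (maxOver-≥ r (degM Y) S ∣S∣≡)
        (Us , P) = pack Y (All.zip (Y-large , Y-small)) Y-maxDeg
    in cliques Y Us , cliques-partialK P Y-small , cliques-disjoint P Y-small ,
       ≤-trans (Δ-cliques P Y-small Y-maxDeg) (*-monoˡ-≤ (Δmulti r Y) (≤-trans (m≤n+m _ (2 * K)) (n≤1+n _)))
  where
  K B C : ℕ
  K = k + h
  B = budget K (r ∸ 1)
  C = suc (2 * K + K * (B + 1))
  1<ε⁻¹ : 1 < ε⁻¹ K
  1<ε⁻¹ = ≤-trans (s≤s (s≤s z≤n)) (*-monoʳ-≤ 4 (m^n>0 2 K))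
  1<γ⁻¹ : 1 < γ⁻¹ r K
  1<γ⁻¹ = *-mono-≤ (*-mono-≤ 1<ε⁻¹ (≤-trans 1≤r (≤-trans r≤h (m≤n+m h k)))) (m≤n+m 1 B)
  instance
    ε⁻¹-nonZero : NonZero (ε⁻¹ K)
    ε⁻¹-nonZero = >-nonZero (<-trans (s≤s z≤n) 1<ε⁻¹)
    γ⁻¹-nonZero : NonZero (γ⁻¹ r K)
    γ⁻¹-nonZero = >-nonZero (<-trans (s≤s z≤n) 1<γ⁻¹)
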